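{- In the setting described in the context, for every non-root vertex $v$ of $G$, \[\sum_{w\in\mathcal I_v}\max(0,1-\varepsilon_w)\le \frac{5}{6}\Big(x^*(v)-2-\sum_{w\in\mathcal I_v}u_w\Big).\]
   Context: Let $G=(V,E)$ be a 2-vertex-connected undirected graph. The Held-Karp relaxation $LP(G)$ is: minimize $\sum_{e\in E}x_e$ subject to $x(\delta(S))\ge 2$ for all $\emptyset\ne S\subsetneq V$ and $x_e\ge 0$, where $\delta(S)$ is the set of edges with exactly one endpoint in $S$ and $x(F)=\sum_{e\in F}x_e$. Let $x^*$ be an extreme-point optimal solution of $LP(G)$, and assume $x^*_e>0$ for every $e\in E$. For a vertex $v$, $x^*(v)=\sum_{e\ni v}x^*_e$. Let $T$ be a depth-first-search spanning tree of $G$ from a root $r$, built by always following (to an unvisited vertex) the edge $e$ with the highest value $x^*_e$. Direct tree edges away from the root (tree-arcs) and all other edges towards the root (back-arcs). Build the network $C(G,T)$: for each non-root vertex $v$ with children $w_1,\dots,w_l$ in $T$, add new vertices $v_1,\dots,v_l$, replace the tree-arc $(v,w_j)$ by tree-arcs $(v,v_j)$ and $(v_j,w_j)$, and redirect to $v_j$ all back-arcs that leave the subtree rooted at $w_j$ and enter $v$. The set of these new vertices $v_1,\dots,v_l$ is $\mathcal I_v$ (in-vertices of $v$'s gadget). For an in-vertex $w$, $t_w$ is its unique outgoing arc and $B(w)$ is its set of incoming arcs; these arcs correspond to edges of $G$ and $x^*$ of such an arc means $x^*$ of that edge. The circulation $f'$ sends, for each back-arc $a$, flow $\min(x^*_a,1)$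 around the unique directed cycle formed by $a$ and tree-arcs. For an in-vertex $w$, $l_w=\min(2-x^*_{t_w},f'(B(w)))$ and $u_w=f'(B(w))-l_w$, where $f'(B(w))$ is the total flow of $f'$ on arcs of $B(w)$. For $w=v_j\in\mathcal I_v$, let $T_w$ be the vertex set of the subtree of $T$ rooted at $w_j$, and let $\varepsilon_w$ be the total $x^*$-value of edges of $G$ joining a vertex of $T_w$ to a proper ancestor of $v$ in $T$.
   Formalization: The extreme-point optimal solution $x^*$ takes rational values, and its optimality and extremality are only tested against rational feasible points of LP(G). -}

module Defs where

open import Data.Bool.Base using (Bool; true; false; _∧_; _∨_; not; if_then_else_; T)
open import Data.Nat.Base using (ℕ; zero; suc) renaming (_≤_ to _≤ℕ_)
open import Data.Fin.Base using (Fin; toℕ)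
open import Data.Fin.Properties using (_≟_)
open import Data.List.Base using (List; []; _∷_; allFin; foldr; map)
open import Data.Integer.Base using (+_)
open import Data.Rational.Base using (ℚ; 0ℚ; 1ℚ; ½; _+_; _-_; _*_; _/_; _⊔_; _⊓_; _≤_; _<_)
open import Data.Product.Base using (Σ; _×_; ∃; ∃-syntax)
open import Relation.Nullary.Decidable.Core using (does)
open import Relation.Nullary.Negation.Core using (¬_)
open import Relation.Binary.PropositionalEquality.Core using (_≡_; _≢_)

Graph : ℕ → Set
Graph n = Fin n → Fin n → Bool

IsSimple : ∀ {n} → Graph n → Set
IsSimple {n} adj = (∀ (i j : Fin n) → adj i j ≡ adj j i) × (∀ (i : Fin n) → adj i i ≡ false)

_==_ : ∀ {n} → Fin n → Fin n → Bool
i == j = does (i ≟ j)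

data Reach {n} (adj : Graph n) (W : Fin n → Bool) (u : Fin n) : Fin n → Set where
  here : W u ≡ true → Reach adj W u u
  step : ∀ {v w} → Reach adj W u v → adj v w ≡ true → W w ≡ true → Reach adj W u w

ConnectedOn : ∀ {n} → Graph n → (Fin n → Bool) → Set
ConnectedOn {n} adj W = ∀ (u v : Fin n) → W u ≡ true → W v ≡ true → Reach adj W u v

TwoVertexConnected : ∀ {n} → Graph n → Set
TwoVertexConnected {n} adj =
  (3 ≤ℕ n) × ConnectedOn adj (λ _ → true) × (∀ (z : Fin n) → ConnectedOn adj (λ u → not (u == z)))

sumℚ : List ℚ → ℚ
sumℚ = foldr _+_ 0ℚ

Σv : ∀ {n} → (Fin n → ℚ) → ℚ
Σv {n} f = sumℚ (map f (allFin n))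

Σv[_]_ : ∀ {n} → (Fin n → Bool) → (Fin n → ℚ) → ℚ
Σv[ P ] f = Σv (λ i → if P i then f i else 0ℚ)

-- The Held-Karp relaxation LP(G). A vector on E is represented as a
-- function y : Fin n → Fin n → ℚ which is symmetric and zero on non-edges
-- (y i j is the value of edge {i,j}).

EdgeVec : ℕ → Set
EdgeVec n = Fin n → Fin n → ℚ

cut : ∀ {n} → Graph n → EdgeVec n → (Fin n → Bool) → ℚ
cut adj y S = Σv (λ i → Σv (λ j → if S i ∧ not (S j) ∧ adj i j then y i j else 0ℚ))

-- objective Σ_{e ∈ E} y_e : each edge {i,j} counted once (with toℕ i < toℕ j)
cost : ∀ {n} → Graph n → EdgeVec n → ℚ
cost adj y = Σv (λ i → Σv (λ j →
  if does (suc (toℕ i) Data.Nat.Properties.≤? toℕ j) ∧ adj i j then y i j else 0ℚ))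
  where import Data.Nat.Properties

Feasible : ∀ {n} → Graph n → EdgeVec n → Set
Feasible {n} adj y =
  (∀ (i j : Fin n) → y i j ≡ y j i)
  × (∀ (i j : Fin n) → adj i j ≡ false → y i j ≡ 0ℚ)
  × (∀ (i j : Fin n) → adj i j ≡ true → 0ℚ ≤ y i j)
  × (∀ (S : Fin n → Bool) → (∃[ i ] S i ≡ true) → (∃[ j ] S j ≡ false) →
       (+ 2 / 1) ≤ cut adj y S)

Optimal : ∀ {n} → Graph n → EdgeVec n → Set
Optimal adj x = Feasible adj x × (∀ y → Feasible adj y → cost adj x ≤ cost adj y)

Extreme : ∀ {n} → Graph n → EdgeVec n → Set
Extreme {n} adj x = ¬ (Σ (EdgeVec n) λ y → Σ (EdgeVec n) λ z →
  Feasible adj y × Feasible adj z × (∃[ i ] ∃[ j ] y i j ≢ z i j) ×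
  (∀ (i j : Fin n) → x i j ≡ (y i j + z i j) * ½))

-- A run of DFS is described by the current
-- stack (head = current vertex) and the set of visited vertices.  The
-- spanning tree is given by a parent function par (par r is irrelevant).

update : ∀ {n} → (Fin n → Bool) → Fin n → Fin n → Bool
update vis u w = if w == u then true else vis w

data DFSRun {n} (adj : Graph n) (x : EdgeVec n) (par : Fin n → Fin n) :
     List (Fin n) → (Fin n → Bool) → Set where
  done : ∀ {vis} → DFSRun adj x par [] vis
  push : ∀ {v st vis} (u : Fin n) → adj v u ≡ true → vis u ≡ false →
         (∀ (u' : Fin n) → adj v u' ≡ true → vis u' ≡ false → x v u' ≤ x v u) →
         par u ≡ v →
         DFSRun adj x par (u ∷ v ∷ st) (update vis u) →
         DFSRun adj x par (v ∷ st) vis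
  pop  : ∀ {v st vis} →
         (∀ (u' : Fin n) → adj v u' ≡ true → vis u' ≡ true) →
         DFSRun adj x par st vis →
         DFSRun adj x par (v ∷ st) vis

IsGreedyDFSTree : ∀ {n} → Graph n → EdgeVec n → Fin n → (Fin n → Fin n) → Set
IsGreedyDFSTree adj x r par = DFSRun adj x par (r ∷ []) (λ w → w == r)

up : ∀ {n} → Fin n → (Fin n → Fin n) → Fin n → Fin n
up r par y = if y == r then r else par y

upIter : ∀ {n} → Fin n → (Fin n → Fin n) → ℕ → Fin n → Fin n
upIter r par zero y = y
upIter r par (suc k) y = upIter r par k (up r par y)

anyUpTo : ℕ → (ℕ → Bool) → Bool
anyUpTo zero P = P zero
anyUpTo (suc k) P = P (suc k) ∨ anyUpTo k P

isAnc : ∀ {n} → Fin n → (Fin n → Fin n) → Fin n → Fin n → Bool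
isAnc {n} r par a y = anyUpTo n (λ k → upIter r par k y == a)

isChild : ∀ {n} → Fin n → (Fin n → Fin n) → Fin n → Fin n → Bool
isChild r par v c = not (c == r) ∧ (par c == v)

-- Quantities attached to the in-vertex w = v_c of v's gadget, for a child c
-- of v.

xdeg : ∀ {n} → Graph n → EdgeVec n → Fin n → ℚ
xdeg adj x v = Σv[ adj v ] (λ u → x v u)

-- f'(B(w)): B(w) = back-arcs from T_c (the subtree of c) into v, i.e. the
-- non-tree edges {y,v} with y in T_c (y ≠ c); each carries min(x,1)
fB : ∀ {n} → Graph n → EdgeVec n → Fin n → (Fin n → Fin n) → Fin n → Fin n → ℚ
fB adj x r par v c =
  Σv[ (λ y → isAnc r par c y ∧ not (y == c) ∧ adj y v) ] (λ y → x y v ⊓ 1ℚ)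

-- l_w = min(2 - x*(t_w), f'(B(w))), t_w being the tree edge {v,c}
lw : ∀ {n} → Graph n → EdgeVec n → Fin n → (Fin n → Fin n) → Fin n → Fin n → ℚ
lw adj x r par v c = ((+ 2 / 1) - x v c) ⊓ fB adj x r par v c

uw : ∀ {n} → Graph n → EdgeVec n → Fin n → (Fin n → Fin n) → Fin n → Fin n → ℚ
uw adj x r par v c = fB adj x r par v c - lw adj x r par v c

εw : ∀ {n} → Graph n → EdgeVec n → Fin n → (Fin n → Fin n) → Fin n → Fin n → ℚ
εw adj x r par v c =
  Σv[ isAnc r par c ] (λ y →
    Σv[ (λ a → isAnc r par a v ∧ not (a == v) ∧ adj y a) ] (λ a → x y a))

module Submission where

-- Write R c for
-- the x-weight of the edges between v and T_c.
--
--  * A DFS tree is a palm tree (no cross edges), so an edge leaving T_c ends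
--    at v or at a proper ancestor of v, and distinct T_c are disjoint.
--  * The cut at T_c gives 2 ≤ R c + ε_c.  For the children K with ε_c < 1,
--    the cut at {v} ∪ ⋃_K T_c gives 2 ≤ A + Σ_K ε, where A is the weight at
--    v leaving this set; disjointness bounds A + Σ_K R and Σ_c R by x*(v).
--  * From f'(B(w)) + x*(t_w) ≤ R c follows u_w + min(R c, 2) ≤ R c.
--  * These inequalities combine linearly (linear-core).

open import Defs
open import Data.Bool.Base using (Bool; true; false; _∧_; _∨_; not; if_then_else_)
open import Data.Bool.Properties using (∨-zeroʳ) renaming (_≟_ to _≟ᵇ_)
open import Data.Empty using (⊥; ⊥-elim)
open import Data.Fin.Base using (Fin; zero; suc; toℕ; punchIn)
open import Data.Fin.Properties using (_≟_; any?; pigeonhole; punchInᵢ≢i; toℕ<n)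
open import Data.Integer.Base using (+_)
open import Data.List.Base using (List; []; _∷_; allFin; tabulate)
open import Data.List.Properties using (map-cong; map-tabulate)
open import Data.List.Relation.Unary.Any using (here; there)
import Data.List.Relation.Unary.All as All
import Data.List.Relation.Unary.AllPairs as AllPairs
open import Data.List.Relation.Unary.Linked as Linked using (Linked; [-]; _∷_)
open import Data.List.Relation.Unary.Linked.Properties using (Linked⇒AllPairs)
open import Data.Nat.Base as ℕ using (ℕ; zero; suc)
import Data.Nat.Properties as ℕ
open import Data.Nat.Induction using (<-rec)
open import Data.Product.Base using (_×_; _,_; ∃-syntax; proj₁; proj₂)
open import Data.Rational.Base using (ℚ; 0ℚ; 1ℚ; _+_; _-_; -_; _*_; _/_; _⊔_; _⊓_; _≤_; _<_)
open import Data.Rational.Properties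
  using ( _<?_; ≤-refl; ≤-trans; ≤-reflexive; ≤-total; <⇒≤; ≮⇒≥; module ≤-Reasoning
        ; +-mono-≤; +-monoˡ-≤; +-monoʳ-≤; *-monoˡ-≤-nonNeg; +-identityʳ; +-identityˡ
        ; +-inverseʳ; +-comm; +-0-commutativeMonoid; positive⁻¹
        ; p≤q⇒p⊓q≡p; p≥q⇒p⊓q≡q; p⊓q≤p; p⊓q≤q; ⊓-glb; p≤q⇒p⊔q≡q; p≥q⇒p⊔q≡p; p≤p⊔q)
open import Data.Rational.Solver using (module +-*-Solver)
open import Data.Sum.Base using (_⊎_; inj₁; inj₂)
open import Function.Base using (_∘_; id)
open import Relation.Binary.PropositionalEquality
open import Relation.Nullary using (Dec; yes; no; ¬_; does; contradiction)
open import Relation.Nullary.Decidable using (dec-true; dec-false)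
import Algebra.Properties.CommutativeMonoid.Sum +-0-commutativeMonoid as ∑

open +-*-Solver using (solve; _:+_; _:-_; _:*_; con; _:=_)

2ℚ : ℚ
2ℚ = + 2 / 1

∧-true : ∀ {a b} → a ∧ b ≡ true → a ≡ true × b ≡ true
∧-true {true} b≡true = refl , b≡true

clash : ∀ {b} → b ≡ true → b ≡ false → ⊥
clash refl ()

not-true : ∀ {b} → not b ≡ true → b ≡ false
not-true {false} _ = refl

does-true : ∀ {P : Set} (P? : Dec P) → does P? ≡ true → P
does-true (yes p) _ = p

does-false : ∀ {P : Set} (P? : Dec P) → does P? ≡ false → ¬ P
does-false (no ¬p) _ = ¬p

∨-false : ∀ {a b} → a ∨ b ≡ false → a ≡ false × b ≡ false
∨-false {false} b≡false = refl , b≡false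

anyᵇ : ∀ {n} → (Fin n → Bool) → Bool
anyᵇ p = does (any? (λ c → p c ≟ᵇ true))

anyᵇ-witness : ∀ {n} (p : Fin n → Bool) → anyᵇ p ≡ true → ∃[ c ] p c ≡ true
anyᵇ-witness p = does-true (any? (λ c → p c ≟ᵇ true))

anyᵇ-none : ∀ {n} (p : Fin n → Bool) → anyᵇ p ≡ false → ∀ c → p c ≡ false
anyᵇ-none p none c with p c in pc
... | true  = contradiction (c , pc) (does-false (any? (λ c → p c ≟ᵇ true)) none)
... | false = refl

anyᵇ-false : ∀ {n} (p : Fin n → Bool) → (∀ c → p c ≡ false) → anyᵇ p ≡ false
anyᵇ-false p none = dec-false (any? (λ c → p c ≟ᵇ true)) λ (c , pc) → contradiction (trans (sym pc) (none c)) λ ()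

==-sound : ∀ {n} {i j : Fin n} → (i == j) ≡ true → i ≡ j
==-sound {i = i} {j} = does-true (i ≟ j)

==-refl : ∀ {n} (i : Fin n) → (i == i) ≡ true
==-refl i = dec-true (i ≟ i) refl

==-false : ∀ {n} {i j : Fin n} → i ≢ j → (i == j) ≡ false
==-false {i = i} {j} = dec-false (i ≟ j)

p≤p+q : ∀ {p q} → 0ℚ ≤ q → p ≤ p + q
p≤p+q {p} 0≤q = subst (_≤ p + _) (+-identityʳ p) (+-monoʳ-≤ p 0≤q)

+-cancelʳ-≤ : ∀ c {a b} → a + c ≤ b + c → a ≤ b
+-cancelʳ-≤ c {a} {b} h = subst₂ _≤_ (cancel a) (cancel b) (+-monoˡ-≤ (- c) h)
  where
  cancel : ∀ p → p + c - c ≡ p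
  cancel p = solve 2 (λ p c → p :+ c :- c := p) refl p c

⊓-subadditive : ∀ {a b t} → 0ℚ ≤ a → 0ℚ ≤ b → 0ℚ ≤ t → (a + b) ⊓ t ≤ a ⊓ t + b ⊓ t
⊓-subadditive {a} {b} {t} 0≤a 0≤b 0≤t with ≤-total a t | ≤-total b t
... | inj₂ t≤a | _ = begin
  (a + b) ⊓ t   ≤⟨ p⊓q≤q (a + b) t ⟩
  t             ≤⟨ p≤p+q (⊓-glb 0≤b 0≤t) ⟩
  t + b ⊓ t     ≡⟨ cong (_+ b ⊓ t) (p≥q⇒p⊓q≡q t≤a) ⟨
  a ⊓ t + b ⊓ t ∎
  where open ≤-Reasoning
... | inj₁ _ | inj₂ t≤b = begin
  (a + b) ⊓ t   ≤⟨ p⊓q≤q (a + b) t ⟩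
  t             ≤⟨ p≤p+q (⊓-glb 0≤a 0≤t) ⟩
  t + a ⊓ t     ≡⟨ +-comm t (a ⊓ t) ⟩
  a ⊓ t + t     ≡⟨ cong (λ m → a ⊓ t + m) (p≥q⇒p⊓q≡q t≤b) ⟨
  a ⊓ t + b ⊓ t ∎
  where open ≤-Reasoning
... | inj₁ a≤t | inj₁ b≤t = begin
  (a + b) ⊓ t   ≤⟨ p⊓q≤p (a + b) t ⟩
  a + b         ≡⟨ cong₂ _+_ (p≤q⇒p⊓q≡p a≤t) (p≤q⇒p⊓q≡p b≤t) ⟨
  a ⊓ t + b ⊓ t ∎
  where open ≤-Reasoning

-- If f + t ≤ R, then the excess f - min(k - t, f) of f over k - t and
-- min(R, k) together still fit into R.  (Applied with f = f'(B(w)),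
-- t = x*(t_w), k = 2, this bounds u_w.)
excess-bound : ∀ k t f R → f + t ≤ R → (f - (k - t) ⊓ f) + R ⊓ k ≤ R
excess-bound k t f R f+t≤R with ≤-total (k - t) f
... | inj₁ k-t≤f = begin
  (f - (k - t) ⊓ f) + R ⊓ k ≡⟨ cong (λ m → (f - m) + R ⊓ k) (p≤q⇒p⊓q≡p k-t≤f) ⟩
  (f - (k - t)) + R ⊓ k     ≤⟨ +-monoʳ-≤ (f - (k - t)) (p⊓q≤q R k) ⟩
  (f - (k - t)) + k         ≡⟨ solve 3 (λ f k t → (f :- (k :- t)) :+ k := f :+ t) refl f k t ⟩
  f + t                     ≤⟨ f+t≤R ⟩
  R                         ∎
  where open ≤-Reasoning
... | inj₂ f≤k-t = begin
  (f - (k - t) ⊓ f) + R ⊓ k ≡⟨ cong (λ m → (f - m) + R ⊓ k) (p≥q⇒p⊓q≡q f≤k-t) ⟩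
  (f - f) + R ⊓ k           ≡⟨ solve 2 (λ f m → (f :- f) :+ m := m) refl f (R ⊓ k) ⟩
  R ⊓ k                     ≤⟨ p⊓q≤p R k ⟩
  R                         ∎
  where open ≤-Reasoning

child-bound : ∀ {R ε u} → 0ℚ ≤ ε → ε ≤ 1ℚ → 2ℚ ≤ R + ε → u + R ⊓ 2ℚ ≤ R →
  (0ℚ ⊔ (1ℚ - ε)) + (0ℚ ⊔ (1ℚ - ε)) + u + ε ≤ R
child-bound {R} {ε} {u} 0≤ε ε≤1 2≤R+ε u+m≤R = begin
  ℓ + ℓ + u + ε               ≡⟨ cong (λ l → l + l + u + ε) ℓ≡1-ε ⟩
  (1ℚ - ε) + (1ℚ - ε) + u + ε ≡⟨ solve 2 (λ ε u → (con 1ℚ :- ε) :+ (con 1ℚ :- ε) :+ u :+ ε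
                                              := u :+ (con 2ℚ :- ε)) refl ε u ⟩
  u + (2ℚ - ε)                ≤⟨ +-monoʳ-≤ u (⊓-glb 2-ε≤R 2-ε≤2) ⟩
  u + R ⊓ 2ℚ                  ≤⟨ u+m≤R ⟩
  R                           ∎
  where
  open ≤-Reasoning
  ℓ : ℚ
  ℓ = 0ℚ ⊔ (1ℚ - ε)
  ℓ≡1-ε : ℓ ≡ 1ℚ - ε
  ℓ≡1-ε = p≤q⇒p⊔q≡q (subst (_≤ 1ℚ - ε) (+-inverseʳ ε) (+-monoˡ-≤ (- ε) ε≤1))
  2-ε≤R : 2ℚ - ε ≤ R
  2-ε≤R = subst (2ℚ - ε ≤_) (solve 2 (λ R ε → R :+ ε :- ε := R) refl R ε) (+-monoˡ-≤ (- ε) 2≤R+ε)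
  2-ε≤2 : 2ℚ - ε ≤ 2ℚ
  2-ε≤2 = subst (2ℚ - ε ≤_) (solve 1 (λ ε → con 2ℚ :- ε :+ ε := con 2ℚ) refl ε) (p≤p+q 0≤ε)

half⇒five-sixths : ∀ {L Q} → 0ℚ ≤ L → L + L ≤ Q → L ≤ (+ 5 / 6) * Q
half⇒five-sixths {L} {Q} 0≤L L+L≤Q = begin
  L                    ≤⟨ p≤p+q (*-monoˡ-≤-nonNeg (+ 2 / 3) 0≤L) ⟩
  L + (+ 2 / 3) * L    ≡⟨ solve 1 (λ L → L :+ con (+ 2 / 3) :* L := con (+ 5 / 6) :* (L :+ L)) refl L ⟩
  (+ 5 / 6) * (L + L)  ≤⟨ *-monoˡ-≤-nonNeg (+ 5 / 6) L+L≤Q ⟩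
  (+ 5 / 6) * Q        ∎
  where open ≤-Reasoning

-- Here L is the left-hand side, X = x*(v),
-- the children of v are split into K (ε_w < 1) and N (the rest), Rₖ, Rₙ,
-- Uₖ, Uₙ are the sums of R and u over K and N, Eₖ is the sum of ε over K,
-- and A is the x-weight at v not going into the subtrees of K.
linear-core : ∀ {X A L Eₖ Rₖ Rₙ Uₖ Uₙ} →
  L + L + Uₖ + Eₖ ≤ Rₖ → Uₙ + Rₙ ⊓ 2ℚ ≤ Rₙ →
  2ℚ ≤ A + Eₖ → A + Rₖ ≤ X → Rₖ + Rₙ ≤ X → 0ℚ ≤ Eₖ →
  L + L ≤ X - 2ℚ - (Uₖ + Uₙ)
linear-core {X} {A} {L} {Eₖ} {Rₖ} {Rₙ} {Uₖ} {Uₙ} hK hN hU hA hC 0≤Eₖ =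
  subst₂ _≤_ (solve 2 (λ L U → L :+ L :+ U :+ con 2ℚ :- (U :+ con 2ℚ) := L :+ L) refl L U)
             (solve 2 (λ X U → X :- (U :+ con 2ℚ) := X :- con 2ℚ :- U) refl X U)
             (+-monoˡ-≤ (- (U + 2ℚ)) total)
  where
  open ≤-Reasoning
  U : ℚ
  U = Uₖ + Uₙ
  total : L + L + U + 2ℚ ≤ X
  total with ≤-total Rₙ 2ℚ
  -- if Rₙ ≤ 2 then Uₙ ≤ 0, and the 2 is paid by A + Eₖ
  ... | inj₁ Rₙ≤2 = +-cancelʳ-≤ Rₙ (begin
    L + L + U + 2ℚ + Rₙ              ≤⟨ +-monoˡ-≤ Rₙ (+-monoʳ-≤ (L + L + U) hU) ⟩
    L + L + U + (A + Eₖ) + Rₙ        ≡⟨ solve 6 (λ L Uₖ Uₙ A Eₖ Rₙ →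
                                          L :+ L :+ (Uₖ :+ Uₙ) :+ (A :+ Eₖ) :+ Rₙ
                                          := (L :+ L :+ Uₖ :+ Eₖ) :+ (Uₙ :+ Rₙ) :+ A) refl L Uₖ Uₙ A Eₖ Rₙ ⟩
    (L + L + Uₖ + Eₖ) + (Uₙ + Rₙ) + A ≤⟨ +-monoˡ-≤ A (+-mono-≤ hK (subst (λ m → Uₙ + m ≤ Rₙ) (p≤q⇒p⊓q≡p Rₙ≤2) hN)) ⟩
    Rₖ + Rₙ + A                      ≡⟨ solve 3 (λ Rₖ Rₙ A → Rₖ :+ Rₙ :+ A := A :+ Rₖ :+ Rₙ) refl Rₖ Rₙ A ⟩
    A + Rₖ + Rₙ                      ≤⟨ +-monoˡ-≤ Rₙ hA ⟩
    X + Rₙ                           ∎)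
  -- if Rₙ ≥ 2 then the 2 is paid by Rₙ
  ... | inj₂ 2≤Rₙ = begin
    L + L + U + 2ℚ                   ≤⟨ p≤p+q 0≤Eₖ ⟩
    L + L + U + 2ℚ + Eₖ              ≡⟨ solve 4 (λ L Uₖ Uₙ Eₖ →
                                          L :+ L :+ (Uₖ :+ Uₙ) :+ con 2ℚ :+ Eₖ
                                          := (L :+ L :+ Uₖ :+ Eₖ) :+ (Uₙ :+ con 2ℚ)) refl L Uₖ Uₙ Eₖ ⟩
    (L + L + Uₖ + Eₖ) + (Uₙ + 2ℚ)    ≤⟨ +-mono-≤ hK (subst (λ m → Uₙ + m ≤ Rₙ) (p≥q⇒p⊓q≡q 2≤Rₙ) hN) ⟩
    Rₖ + Rₙ                          ≤⟨ hC ⟩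
    X                                ∎

-- Σv is the library's vector sum, so its algebraic laws are inherited.
Σv≡sum : ∀ {n} (f : Fin n → ℚ) → Σv f ≡ ∑.sum f
Σv≡sum {n} f = trans (cong sumℚ (map-tabulate id f)) (sumℚ-tabulate f)
  where
  sumℚ-tabulate : ∀ {m} (g : Fin m → ℚ) → sumℚ (tabulate g) ≡ ∑.sum g
  sumℚ-tabulate {zero}  g = refl
  sumℚ-tabulate {suc m} g = cong (λ s → g zero + s) (sumℚ-tabulate (g ∘ suc))

module _ {n : ℕ} where

  Σv-cong : ∀ {f g : Fin n → ℚ} → (∀ i → f i ≡ g i) → Σv f ≡ Σv g
  Σv-cong f≗g = cong sumℚ (map-cong f≗g (allFin n))

  Σv-zero : Σv {n} (λ _ → 0ℚ) ≡ 0ℚ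
  Σv-zero = trans (Σv≡sum {n} (λ _ → 0ℚ)) (∑.sum-replicate-zero n)

  Σv-+ : ∀ (f g : Fin n → ℚ) → Σv (λ i → f i + g i) ≡ Σv f + Σv g
  Σv-+ f g = begin
    Σv (λ i → f i + g i)    ≡⟨ Σv≡sum (λ i → f i + g i) ⟩
    ∑.sum (λ i → f i + g i) ≡⟨ ∑.∑-distrib-+ f g ⟩
    ∑.sum f + ∑.sum g       ≡⟨ cong₂ _+_ (Σv≡sum f) (Σv≡sum g) ⟨
    Σv f + Σv g             ∎
    where open ≡-Reasoning

  Σv-comm : ∀ (f : Fin n → Fin n → ℚ) → Σv (λ i → Σv (f i)) ≡ Σv (λ j → Σv (λ i → f i j))
  Σv-comm f = begin
    Σv (λ i → Σv (f i))                    ≡⟨ trans (Σv≡sum (λ i → Σv (f i))) (∑.sum-cong-≗ (λ i → Σv≡sum (f i))) ⟩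
    ∑.sum (λ i → ∑.sum (f i))              ≡⟨ ∑.∑-comm f ⟩
    ∑.sum (λ j → ∑.sum (λ i → f i j))      ≡⟨ trans (Σv≡sum (λ j → Σv (λ i → f i j))) (∑.sum-cong-≗ (λ j → Σv≡sum (λ i → f i j))) ⟨
    Σv (λ j → Σv (λ i → f i j))            ∎
    where open ≡-Reasoning

  Σv-mono : ∀ {f g : Fin n → ℚ} → (∀ i → f i ≤ g i) → Σv f ≤ Σv g
  Σv-mono {f} {g} f≤g = subst₂ _≤_ (sym (Σv≡sum f)) (sym (Σv≡sum g)) (sum-mono f≤g)
    where
    sum-mono : ∀ {m} {f g : Fin m → ℚ} → (∀ i → f i ≤ g i) → ∑.sum f ≤ ∑.sum g
    sum-mono {zero}  _   = ≤-refl
    sum-mono {suc m} f≤g = +-mono-≤ (f≤g zero) (sum-mono (f≤g ∘ suc))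

  Σv-nonneg : ∀ {f : Fin n → ℚ} → (∀ i → 0ℚ ≤ f i) → 0ℚ ≤ Σv f
  Σv-nonneg {f} 0≤f = subst (_≤ Σv f) Σv-zero (Σv-mono 0≤f)

  Σv-if : ∀ (b : Bool) (f : Fin n → ℚ) → Σv (λ j → if b then f j else 0ℚ) ≡ (if b then Σv f else 0ℚ)
  Σv-if true  f = refl
  Σv-if false f = Σv-zero


Σv-supported : ∀ {n} (f : Fin n → ℚ) (c : Fin n) → (∀ i → i ≢ c → f i ≡ 0ℚ) → Σv f ≡ f c
Σv-supported {suc n} f c off = begin
  Σv f                         ≡⟨ Σv≡sum f ⟩
  ∑.sum f                      ≡⟨ ∑.sum-remove {i = c} f ⟩
  f c + ∑.sum (f ∘ punchIn c)  ≡⟨ cong (λ s → f c + s) rest≡0 ⟩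
  f c + 0ℚ                     ≡⟨ +-identityʳ (f c) ⟩
  f c                          ∎
  where
  open ≡-Reasoning
  rest≡0 : ∑.sum (f ∘ punchIn c) ≡ 0ℚ
  rest≡0 = trans (∑.sum-cong-≗ (λ j → off (punchIn c j) (punchInᵢ≢i c j))) (∑.sum-replicate-zero n)

Σv-term : ∀ {n} (f : Fin n → ℚ) (c : Fin n) → (∀ i → 0ℚ ≤ f i) → f c ≤ Σv f
Σv-term {suc n} f c 0≤f = begin
  f c                          ≤⟨ p≤p+q (subst (0ℚ ≤_) (Σv≡sum (f ∘ punchIn c)) (Σv-nonneg (0≤f ∘ punchIn c))) ⟩
  f c + ∑.sum (f ∘ punchIn c)  ≡⟨ ∑.sum-remove {i = c} f ⟨
  ∑.sum f                      ≡⟨ Σv≡sum f ⟨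
  Σv f                         ∎
  where open ≤-Reasoning

Σv-δ : ∀ {n} (f : Fin n → ℚ) (c : Fin n) → Σv (λ i → if i == c then f i else 0ℚ) ≡ f c
Σv-δ f c = trans (Σv-supported _ c off) (cong (λ b → if b then f c else 0ℚ) (==-refl c))
  where
  off : ∀ i → i ≢ c → (if i == c then f i else 0ℚ) ≡ 0ℚ
  off i i≢c rewrite ==-false i≢c = refl

module _ {n : ℕ} (P : Fin n → Bool) where

  Σv[]-+ : ∀ (f g : Fin n → ℚ) → Σv[ P ] (λ i → f i + g i) ≡ Σv[ P ] f + Σv[ P ] g
  Σv[]-+ f g = trans (Σv-cong guard-+) (Σv-+ (λ i → if P i then f i else 0ℚ) (λ i → if P i then g i else 0ℚ))
    where
    guard-+ : ∀ i → (if P i then f i + g i else 0ℚ) ≡ (if P i then f i else 0ℚ) + (if P i then g i else 0ℚ)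
    guard-+ i with P i
    ... | true  = refl
    ... | false = refl

  Σv[]-mono : ∀ {f g : Fin n → ℚ} → (∀ i → P i ≡ true → f i ≤ g i) → Σv[ P ] f ≤ Σv[ P ] g
  Σv[]-mono {f} {g} f≤g = Σv-mono guarded
    where
    guarded : ∀ i → (if P i then f i else 0ℚ) ≤ (if P i then g i else 0ℚ)
    guarded i with P i in Pi
    ... | true  = f≤g i Pi
    ... | false = ≤-refl

  Σv[]-nonneg : ∀ {f : Fin n → ℚ} → (∀ i → P i ≡ true → 0ℚ ≤ f i) → 0ℚ ≤ Σv[ P ] f
  Σv[]-nonneg {f} 0≤f = Σv-nonneg guarded
    where
    guarded : ∀ i → 0ℚ ≤ (if P i then f i else 0ℚ)
    guarded i with P i in Pi
    ... | true  = 0≤f i Pi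
    ... | false = ≤-refl

  Σv-none : ∀ (f : Fin n → ℚ) → (∀ i → P i ≡ false) → Σv[ P ] f ≡ 0ℚ
  Σv-none f none = trans (Σv-cong off) (Σv-zero {n})
    where
    off : ∀ i → (if P i then f i else 0ℚ) ≡ 0ℚ
    off i rewrite none i = refl

  Σv-split : ∀ (Q : Fin n → Bool) (f : Fin n → ℚ) →
    Σv[ P ] f ≡ Σv[ (λ i → P i ∧ Q i) ] f + Σv[ (λ i → P i ∧ not (Q i)) ] f
  Σv-split Q f = trans (Σv-cong split)
    (Σv-+ (λ i → if P i ∧ Q i then f i else 0ℚ) (λ i → if P i ∧ not (Q i) then f i else 0ℚ))
    where
    split : ∀ i → (if P i then f i else 0ℚ)
                ≡ (if P i ∧ Q i then f i else 0ℚ) + (if P i ∧ not (Q i) then f i else 0ℚ)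
    split i with P i | Q i
    ... | false | _     = refl
    ... | true  | true  = sym (+-identityʳ (f i))
    ... | true  | false = sym (+-identityˡ (f i))

  Σv-at-most-one : ∀ {a} → 0ℚ ≤ a → (∀ i j → P i ≡ true → P j ≡ true → i ≡ j) → Σv[ P ] (λ _ → a) ≤ a
  Σv-at-most-one {a} 0≤a unique with anyᵇ P in found
  ... | true  = let c , Pc = anyᵇ-witness P found in
    ≤-reflexive (trans (Σv-supported _ c (off c Pc)) (cong (λ b → if b then a else 0ℚ) Pc))
    where
    off : ∀ c → P c ≡ true → ∀ i → i ≢ c → (if P i then a else 0ℚ) ≡ 0ℚ
    off c Pc i i≢c with P i in Pi
    ... | true  = contradiction (unique i c Pi Pc) i≢c
    ... | false = refl
  ... | false = subst (_≤ a) (sym (Σv-none _ (anyᵇ-none P found))) 0≤a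

  Σv[]-⊓ : ∀ {f : Fin n → ℚ} {t} → (∀ i → 0ℚ ≤ f i) → 0ℚ ≤ t →
    (Σv[ P ] f) ⊓ t ≤ Σv[ P ] (λ i → f i ⊓ t)
  Σv[]-⊓ {f} {t} 0≤f 0≤t = begin
    (Σv g) ⊓ t             ≡⟨ cong (_⊓ t) (Σv≡sum g) ⟩
    (∑.sum g) ⊓ t          ≤⟨ sum-⊓ g 0≤g ⟩
    ∑.sum (λ i → g i ⊓ t)  ≡⟨ Σv≡sum (λ i → g i ⊓ t) ⟨
    Σv (λ i → g i ⊓ t)     ≤⟨ Σv-mono guarded ⟩
    Σv[ P ] (λ i → f i ⊓ t) ∎
    where
    open ≤-Reasoning
    g : Fin n → ℚ
    g i = if P i then f i else 0ℚ
    0≤g : ∀ i → 0ℚ ≤ g i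
    0≤g i with P i
    ... | true  = 0≤f i
    ... | false = ≤-refl
    guarded : ∀ i → g i ⊓ t ≤ (if P i then f i ⊓ t else 0ℚ)
    guarded i with P i
    ... | true  = ≤-refl
    ... | false = p⊓q≤p 0ℚ t
    sum-⊓ : ∀ {m} (h : Fin m → ℚ) → (∀ i → 0ℚ ≤ h i) → (∑.sum h) ⊓ t ≤ ∑.sum (λ i → h i ⊓ t)
    sum-⊓ {zero}  h _   = p⊓q≤p 0ℚ t
    sum-⊓ {suc m} h 0≤h = ≤-trans
      (⊓-subadditive (0≤h zero) (subst (0ℚ ≤_) (Σv≡sum (h ∘ suc)) (Σv-nonneg (0≤h ∘ suc))) 0≤t)
      (+-monoʳ-≤ (h zero ⊓ t) (sum-⊓ (h ∘ suc) (0≤h ∘ suc)))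

Σv-disjoint : ∀ {n} (h : Fin n → ℚ) (H P : Fin n → Bool) (W : Fin n → Fin n → Bool) →
  (∀ j → 0ℚ ≤ h j) →
  (∀ j c → H j ≡ true → P c ≡ true → W c j ≡ false) →
  (∀ j c c′ → P c ≡ true → P c′ ≡ true → W c j ≡ true → W c′ j ≡ true → c ≡ c′) →
  Σv[ H ] h + Σv[ P ] (λ c → Σv[ W c ] h) ≤ Σv h
Σv-disjoint {n} h H P W 0≤h H∩W≡∅ W-disjoint = begin
  Σv[ H ] h + Σv[ P ] (λ c → Σv[ W c ] h)        ≡⟨ cong (λ s → Σv[ H ] h + s) regroup ⟩
  Σv[ H ] h + Σv (λ j → Σv[ owners j ] (λ _ → h j)) ≡⟨ Σv-+ (λ j → if H j then h j else 0ℚ) _ ⟨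
  Σv (λ j → (if H j then h j else 0ℚ) + Σv[ owners j ] (λ _ → h j)) ≤⟨ Σv-mono at-most-once ⟩
  Σv h                                           ∎
  where
  open ≤-Reasoning
  owners : Fin n → Fin n → Bool
  owners j c = P c ∧ W c j

  regroup : Σv[ P ] (λ c → Σv[ W c ] h) ≡ Σv (λ j → Σv[ owners j ] (λ _ → h j))
  regroup = begin-equality
    Σv (λ c → if P c then Σv[ W c ] h else 0ℚ)
      ≡⟨ Σv-cong (λ c → sym (Σv-if (P c) (λ j → if W c j then h j else 0ℚ))) ⟩
    Σv (λ c → Σv (λ j → if P c then (if W c j then h j else 0ℚ) else 0ℚ))
      ≡⟨ Σv-comm {n} _ ⟩
    Σv (λ j → Σv (λ c → if P c then (if W c j then h j else 0ℚ) else 0ℚ))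
      ≡⟨ Σv-cong (λ j → Σv-cong (λ c → nested-if (P c) (W c j))) ⟩
    Σv (λ j → Σv[ owners j ] (λ _ → h j)) ∎
    where
    nested-if : ∀ {q} a b → (if a then (if b then q else 0ℚ) else 0ℚ) ≡ (if a ∧ b then q else 0ℚ)
    nested-if true  b = refl
    nested-if false b = refl

  at-most-once : ∀ j → (if H j then h j else 0ℚ) + Σv[ owners j ] (λ _ → h j) ≤ h j
  at-most-once j with H j in Hj
  ... | true  = ≤-reflexive (trans (cong (λ s → h j + s) (Σv-none (owners j) _ no-owner)) (+-identityʳ (h j)))
    where
    no-owner : ∀ c → owners j c ≡ false
    no-owner c with P c in Pc
    ... | true  = H∩W≡∅ j c Hj Pc
    ... | false = refl
  ... | false = subst (_≤ h j) (sym (+-identityˡ _))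
      (Σv-at-most-one (owners j) (0≤h j) (λ c c′ o o′ → W-disjoint j c c′ (proj₁ (∧-true o)) (proj₁ (∧-true o′)) (proj₂ (∧-true o)) (proj₂ (∧-true o′))))

anyUpTo-sound : ∀ m (P : ℕ → Bool) → anyUpTo m P ≡ true → ∃[ k ] P k ≡ true
anyUpTo-sound zero    P P0  = zero , P0
anyUpTo-sound (suc m) P any with P (suc m) in Pm
... | true  = suc m , Pm
... | false = anyUpTo-sound m P any

anyUpTo-complete : ∀ m (P : ℕ → Bool) {k} → k ℕ.≤ m → P k ≡ true → anyUpTo m P ≡ true
anyUpTo-complete zero    P ℕ.z≤n Pk = Pk
anyUpTo-complete (suc m) P k≤1+m Pk with ℕ.m≤n⇒m<n∨m≡n k≤1+m
... | inj₂ refl  = cong (_∨ anyUpTo m P) Pk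
... | inj₁ k<1+m = trans (cong (P (suc m) ∨_) (anyUpTo-complete m P (ℕ.≤-pred k<1+m) Pk)) (∨-zeroʳ (P (suc m)))

module Ancestry {n : ℕ} (r : Fin n) (par : Fin n → Fin n) where

  -- climb k y is the vertex k steps above y (the root is its own parent).
  climb : ℕ → Fin n → Fin n
  climb = upIter r par

  Anc : Fin n → Fin n → Set
  Anc a y = ∃[ k ] climb k y ≡ a

  climb-+ : ∀ i d y → climb (i ℕ.+ d) y ≡ climb d (climb i y)
  climb-+ zero    d y = refl
  climb-+ (suc i) d y = climb-+ i d (up r par y)

  climb-root : ∀ k → climb k r ≡ r
  climb-root zero    = refl
  climb-root (suc k) rewrite ==-refl r = climb-root k

  up-nonroot : ∀ {c} → c ≢ r → up r par c ≡ par c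
  up-nonroot c≢r rewrite ==-false c≢r = refl

  climb-further : ∀ i d {j y a b} → i ℕ.+ d ≡ j → climb i y ≡ a → climb j y ≡ b → climb d a ≡ b
  climb-further i d {y = y} i+d≡j refl refl = trans (sym (climb-+ i d y)) (cong (λ k → climb k y) i+d≡j)

  Anc-refl : ∀ a → Anc a a
  Anc-refl a = 0 , refl

  Anc-trans : ∀ {a b c} → Anc a b → Anc b c → Anc a c
  Anc-trans {c = c} (i , climb-i) (j , climb-j) =
    j ℕ.+ i , trans (climb-+ j i c) (trans (cong (climb i) climb-j) climb-i)

  Anc-parent : ∀ {c} → c ≢ r → Anc (par c) c
  Anc-parent c≢r = 1 , up-nonroot c≢r

  Anc-root : ∀ {a} → Anc a r → a ≡ r
  Anc-root (k , climb-k) = trans (sym climb-k) (climb-root k)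

  Anc-comparable : ∀ {a b y} → Anc a y → Anc b y → Anc a b ⊎ Anc b a
  Anc-comparable (i , climb-i) (j , climb-j) with ℕ.≤-total i j
  ... | inj₁ i≤j = let d , i+d≡j = ℕ.m≤n⇒∃[o]m+o≡n i≤j in inj₂ (d , climb-further i d i+d≡j climb-i climb-j)
  ... | inj₂ j≤i = let d , j+d≡i = ℕ.m≤n⇒∃[o]m+o≡n j≤i in inj₁ (d , climb-further j d j+d≡i climb-j climb-i)

  Anc-of-parent : ∀ {a c} → Anc a c → a ≢ c → c ≢ r → Anc a (par c)
  Anc-of-parent (zero  , c≡a)     a≢c _   = contradiction (sym c≡a) a≢c
  Anc-of-parent (suc k , climb-k) _   c≢r = k , trans (cong (climb k) (sym (up-nonroot c≢r))) climb-k

  cycle⇒root : ∀ {c} L → climb (suc L) c ≡ c → Anc r c → c ≡ r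
  cycle⇒root {c} L cyc (k , climb-k) = begin
    c                      ≡⟨ iterate k ⟨
    climb (k ℕ.* suc L) c  ≡⟨ climb-further k d k+d≡ climb-k refl ⟨
    climb d r              ≡⟨ climb-root d ⟩
    r                      ∎
    where
    open ≡-Reasoning
    iterate : ∀ m → climb (m ℕ.* suc L) c ≡ c
    iterate zero    = refl
    iterate (suc m) = trans (climb-+ (suc L) (m ℕ.* suc L) c) (trans (cong (climb (m ℕ.* suc L)) cyc) (iterate m))
    d : ℕ
    d = proj₁ (ℕ.m≤n⇒∃[o]m+o≡n (ℕ.m≤m*n k (suc L)))
    k+d≡ : k ℕ.+ d ≡ k ℕ.* suc L
    k+d≡ = proj₂ (ℕ.m≤n⇒∃[o]m+o≡n (ℕ.m≤m*n k (suc L)))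

  -- Every ancestor is reached within n steps: by the pigeonhole principle a
  -- longer climb repeats a vertex, and the repeated segment can be cut out.
  Anc-bounded : ∀ {a y} k → climb k y ≡ a → ∃[ k′ ] k′ ℕ.≤ n × climb k′ y ≡ a
  Anc-bounded {a} {y} = <-rec (λ k → climb k y ≡ a → ∃[ k′ ] k′ ℕ.≤ n × climb k′ y ≡ a) shorten
    where
    shorten : ∀ k → (∀ {k′} → k′ ℕ.< k → climb k′ y ≡ a → ∃[ k″ ] k″ ℕ.≤ n × climb k″ y ≡ a) →
              climb k y ≡ a → ∃[ k′ ] k′ ℕ.≤ n × climb k′ y ≡ a
    shorten k shorter climb-k with k ℕ.≤? n
    ... | yes k≤n = k , k≤n , climb-k
    ... | no  k≰n with pigeonhole (ℕ.n<1+n n) (λ (i : Fin (suc n)) → climb (toℕ i) y)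
    ...   | i , j , i<j , repeat =
      let d , j+d≡k = ℕ.m≤n⇒∃[o]m+o≡n (ℕ.<⇒≤ (ℕ.≤-<-trans (ℕ.≤-pred (toℕ<n j)) (ℕ.≰⇒> k≰n)))
      in shorter (subst (toℕ i ℕ.+ d ℕ.<_) j+d≡k (ℕ.+-monoˡ-< d i<j))
                 (trans (climb-+ (toℕ i) d y) (trans (cong (climb d) repeat) (climb-further (toℕ j) d j+d≡k refl climb-k)))

  isAnc-sound : ∀ {a y} → isAnc r par a y ≡ true → Anc a y
  isAnc-sound {a} {y} found =
    let k , climb-k = anyUpTo-sound n (λ k → climb k y == a) found in k , ==-sound climb-k

  isAnc-complete : ∀ {a y} → Anc a y → isAnc r par a y ≡ true
  isAnc-complete {a} {y} (k , climb-k) =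
    let k′ , k′≤n , climb-k′ = Anc-bounded k climb-k
    in anyUpTo-complete n (λ k → climb k y == a) k′≤n (trans (cong (_== a) climb-k′) (==-refl a))

record IsPalmTree {n} (adj : Graph n) (r : Fin n) (par : Fin n → Fin n) : Set where
  field
    reaches-root   : ∀ w → Ancestry.Anc r par r w
    no-cross-edges : ∀ z y → adj z y ≡ true → Ancestry.Anc r par y z ⊎ Ancestry.Anc r par z y

module DepthFirstSearch {n : ℕ} (adj : Graph n) (adj-sym : ∀ i j → adj i j ≡ adj j i)
                        (x : EdgeVec n) (r : Fin n) (par : Fin n → Fin n) where

  open Ancestry r par
  open import Data.List.Membership.DecPropositional (_≟_ {n}) using (_∈_; _∉_; _∈?_)

  -- The stack is linked by Below: each entry is a descendant of the next.
  Below : Fin n → Fin n → Set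
  Below s s′ = Anc s′ s

  below-top : ∀ {t s rest} → Linked Below (t ∷ rest) → s ∈ rest → Anc s t
  below-top path = All.lookup (AllPairs.head (Linked⇒AllPairs (λ b b′ → Anc-trans b′ b) path))

  -- Invariant of a run with stack st (current vertex first) and visited set
  -- vis; a visited vertex that has left the stack is finished.
  record Invariant (st : List (Fin n)) (vis : Fin n → Bool) : Set where
    field
      root-visited    : vis r ≡ true
      visited-rooted  : ∀ w → vis w ≡ true → Anc r w
      stack-path      : Linked Below st
      stack-visited   : ∀ s → s ∈ st → vis s ≡ true
      finished-below  : ∀ z s → vis z ≡ true → z ∉ st → s ∈ st → adj s z ≡ true → Anc s z
      finished-closed : ∀ z y → vis z ≡ true → z ∉ st → adj z y ≡ true → vis y ≡ true × (Anc y z ⊎ Anc z y)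

  initial : Invariant (r ∷ []) (λ w → w == r)
  initial = record
    { root-visited    = ==-refl r
    ; visited-rooted  = λ w w==r → 0 , ==-sound w==r
    ; stack-path      = [-]
    ; stack-visited   = λ { s (here refl) → ==-refl r }
    ; finished-below  = λ z _ z==r z∉st _ _ → contradiction (here (==-sound z==r)) z∉st
    ; finished-closed = λ z _ z==r z∉st _ → contradiction (here (==-sound z==r)) z∉st
    }

  update-visited : ∀ (vis : Fin n → Bool) u w → vis w ≡ true → update vis u w ≡ true
  update-visited vis u w vis-w with w == u
  ... | true  = refl
  ... | false = vis-w

  push-step : ∀ {v st vis} u → vis u ≡ false → par u ≡ v →
    Invariant (v ∷ st) vis → Invariant (u ∷ v ∷ st) (update vis u)
  push-step {v} {st} {vis} u u-new par-u inv = record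
    { root-visited    = update-visited vis u r I.root-visited
    ; visited-rooted  = rooted
    ; stack-path      = u-below-v ∷ I.stack-path
    ; stack-visited   = λ { s (here refl) → vis-u ; s (there s∈) → update-visited vis u s (I.stack-visited s s∈) }
    ; finished-below  = below
    ; finished-closed = closed
    }
    where
    module I = Invariant inv
    vis-u : update vis u u ≡ true
    vis-u rewrite ==-refl u = refl
    u≢r : u ≢ r
    u≢r refl = contradiction (trans (sym I.root-visited) u-new) λ ()
    u-below-v : Below u v
    u-below-v = subst (λ p → Anc p u) par-u (Anc-parent u≢r)
    rooted : ∀ w → update vis u w ≡ true → Anc r w
    rooted w vis-w with w == u in w==u
    ... | true  = subst (λ w → Anc r w) (sym (==-sound w==u))
                    (Anc-trans (I.visited-rooted v (I.stack-visited v (here refl))) u-below-v)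
    ... | false = I.visited-rooted w vis-w
    was-finished : ∀ {z} → update vis u z ≡ true → z ∉ u ∷ v ∷ st → vis z ≡ true × z ∉ v ∷ st
    was-finished {z} vis-z z∉ with z == u in z==u
    ... | true  = contradiction (here (==-sound z==u)) z∉
    ... | false = vis-z , z∉ ∘ there
    below : ∀ z s → update vis u z ≡ true → z ∉ u ∷ v ∷ st → s ∈ u ∷ v ∷ st → adj s z ≡ true → Anc s z
    below z s vis-z z∉ (here refl) u~z =
      let vis-z′ , z∉′ = was-finished vis-z z∉
      in contradiction (trans (sym (proj₁ (I.finished-closed z u vis-z′ z∉′ (trans (adj-sym z u) u~z)))) u-new) λ ()
    below z s vis-z z∉ (there s∈) s~z = let vis-z′ , z∉′ = was-finished vis-z z∉ in I.finished-below z s vis-z′ z∉′ s∈ s~z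
    closed : ∀ z y → update vis u z ≡ true → z ∉ u ∷ v ∷ st → adj z y ≡ true →
             update vis u y ≡ true × (Anc y z ⊎ Anc z y)
    closed z y vis-z z∉ z~y =
      let vis-z′ , z∉′ = was-finished vis-z z∉
          vis-y , comparable = I.finished-closed z y vis-z′ z∉′ z~y
      in update-visited vis u y vis-y , comparable

  pop-step : ∀ {v st vis} → (∀ u → adj v u ≡ true → vis u ≡ true) →
    Invariant (v ∷ st) vis → Invariant st vis
  pop-step {v} {st} {vis} all-visited inv = record
    { root-visited    = I.root-visited
    ; visited-rooted  = I.visited-rooted
    ; stack-path      = Linked.tail I.stack-path
    ; stack-visited   = λ s s∈ → I.stack-visited s (there s∈)
    ; finished-below  = below
    ; finished-closed = closed
    }
    where
    module I = Invariant inv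
    below : ∀ z s → vis z ≡ true → z ∉ st → s ∈ st → adj s z ≡ true → Anc s z
    below z s vis-z z∉ s∈ s~z with z ≟ v
    ... | yes refl = below-top I.stack-path s∈
    ... | no  z≢v  = I.finished-below z s vis-z (λ { (here z≡v) → z≢v z≡v ; (there z∈) → z∉ z∈ }) (there s∈) s~z
    closed : ∀ z y → vis z ≡ true → z ∉ st → adj z y ≡ true → vis y ≡ true × (Anc y z ⊎ Anc z y)
    closed z y vis-z z∉ z~y with z ≟ v
    ... | no  z≢v  = I.finished-closed z y vis-z (λ { (here z≡v) → z≢v z≡v ; (there z∈) → z∉ z∈ }) z~y
    ... | yes refl with y ∈? st | y ≟ z
    ...   | yes y∈ | _        = all-visited y z~y , inj₁ (below-top I.stack-path y∈)
    ...   | no  _  | yes refl = all-visited y z~y , inj₁ (Anc-refl y)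
    ...   | no  y∉ | no  y≢z  = all-visited y z~y ,
            inj₂ (I.finished-below y z (all-visited y z~y) (λ { (here y≡z) → y≢z y≡z ; (there y∈) → y∉ y∈ }) (here refl) z~y)

  run : ∀ {st vis} → DFSRun adj x par st vis → Invariant st vis → ∃[ vis′ ] Invariant [] vis′
  run {vis = vis} done                         inv = vis , inv
  run (push u _ u-new _ par-u rest) inv = run rest (push-step u u-new par-u inv)
  run (pop all-visited rest)        inv = run rest (pop-step all-visited inv)

  dfs-palm-tree : ConnectedOn adj (λ _ → true) → IsGreedyDFSTree adj x r par → IsPalmTree adj r par
  dfs-palm-tree connected dfs = record
    { reaches-root   = λ w → F.visited-rooted w (visited w)
    ; no-cross-edges = λ z y z~y → proj₂ (F.finished-closed z y (visited z) (λ ()) z~y)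
    }
    where
    module F = Invariant (proj₂ (run dfs initial))
    -- at the end the stack is empty, so visited vertices are closed under adjacency
    visited : ∀ w → proj₁ (run dfs initial) w ≡ true
    visited w = along (connected r w refl refl)
      where
      along : ∀ {w} → Reach adj (λ _ → true) r w → proj₁ (run dfs initial) w ≡ true
      along (here _)          = F.root-visited
      along (step walk y~w _) = proj₁ (F.finished-closed _ _ (along walk) (λ ()) y~w)

module Subtrees {n : ℕ} (adj : Graph n) (r : Fin n) (par : Fin n → Fin n)
                (palm : IsPalmTree adj r par) (v : Fin n) where

  open Ancestry r par
  open IsPalmTree palm

  child : Fin n → Bool
  child = isChild r par v

  T : Fin n → Fin n → Bool
  T c = isAnc r par c

  child-nonroot : ∀ {c} → child c ≡ true → c ≢ r
  child-nonroot {c} is-child refl rewrite ==-refl c = contradiction is-child λ ()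

  child-parent : ∀ {c} → child c ≡ true → par c ≡ v
  child-parent is-child = ==-sound (proj₂ (∧-true is-child))

  T-self : ∀ c → T c c ≡ true
  T-self c = isAnc-complete (Anc-refl c)

  root-outside : ∀ {c} → child c ≡ true → T c r ≡ false
  root-outside {c} is-child with T c r in r∈
  ... | true  = contradiction (Anc-root (isAnc-sound r∈)) (child-nonroot is-child)
  ... | false = refl

  -- An edge leaving the subtree of a child of v ends at v or at a proper
  -- ancestor of v: a palm tree has no cross edges.
  subtree-exit : ∀ {c y j} → child c ≡ true → T c y ≡ true → T c j ≡ false → adj y j ≡ true →
                 j ≡ v ⊎ (isAnc r par j v ≡ true × j ≢ v)
  subtree-exit {c} {y} {j} is-child y∈ j∉ y~j with no-cross-edges y j y~j
  ... | inj₂ y-anc-j = ⊥-elim (clash (isAnc-complete (Anc-trans (isAnc-sound y∈) y-anc-j)) j∉)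
  ... | inj₁ j-anc-y with Anc-comparable (isAnc-sound y∈) j-anc-y
  ...   | inj₁ c-anc-j = ⊥-elim (clash (isAnc-complete c-anc-j) j∉)
  ...   | inj₂ j-anc-c with j ≟ c | j ≟ v
  ...     | yes refl | _        = ⊥-elim (clash (T-self j) j∉)
  ...     | no  _    | yes j≡v  = inj₁ j≡v
  ...     | no  j≢c  | no  j≢v  =
    inj₂ (isAnc-complete (subst (Anc j) (child-parent is-child) (Anc-of-parent j-anc-c j≢c (child-nonroot is-child))) , j≢v)

  -- A child of v that is an ancestor of a child c′ of v is c′ itself, for
  -- otherwise it would be a non-root vertex lying on a cycle.
  sibling-ancestor : ∀ {c c′} → child c ≡ true → child c′ ≡ true → Anc c c′ → c ≡ c′
  sibling-ancestor {c} {c′} is-child is-child′ c-anc-c′ with c ≟ c′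
  ... | yes c≡c′ = c≡c′
  ... | no  c≢c′ =
    let k , climb-k = Anc-of-parent c-anc-c′ c≢c′ (child-nonroot is-child′)
        same-parent = trans (up-nonroot (child-nonroot is-child))
                            (trans (child-parent is-child) (sym (child-parent is-child′)))
    in contradiction (cycle⇒root k (trans (cong (climb k) same-parent) climb-k) (reaches-root c))
                     (child-nonroot is-child)

  subtrees-disjoint : ∀ {c c′ j} → child c ≡ true → child c′ ≡ true → T c j ≡ true → T c′ j ≡ true → c ≡ c′
  subtrees-disjoint is-child is-child′ j∈ j∈′ with Anc-comparable (isAnc-sound j∈) (isAnc-sound j∈′)
  ... | inj₁ c-anc-c′ = sibling-ancestor is-child is-child′ c-anc-c′
  ... | inj₂ c′-anc-c = sym (sibling-ancestor is-child′ is-child c′-anc-c)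

cut-≤ : ∀ {n} (adj : Graph n) (x : EdgeVec n) (S : Fin n → Bool) (g : Fin n → Fin n → ℚ) →
  (∀ i j → 0ℚ ≤ g i j) → (∀ i j → S i ≡ true → S j ≡ false → adj i j ≡ true → x i j ≤ g i j) →
  cut adj x S ≤ Σv (λ i → Σv (g i))
cut-≤ adj x S g 0≤g dominates = Σv-mono (λ i → Σv-mono (leaving i))
  where
  leaving : ∀ i j → (if S i ∧ not (S j) ∧ adj i j then x i j else 0ℚ) ≤ g i j
  leaving i j with S i in Si | S j in Sj | adj i j in i~j
  ... | true  | false | true  = dominates i j Si Sj i~j
  ... | true  | false | false = 0≤g i j
  ... | true  | true  | _     = 0≤g i j
  ... | false | _     | _     = 0≤g i j

module AtVertex {n : ℕ} (adj : Graph n) (x : EdgeVec n) (feasible : Feasible adj x)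
                (r : Fin n) (par : Fin n → Fin n) (palm : IsPalmTree adj r par)
                (v : Fin n) (v≢r : v ≢ r) where

  open Subtrees adj r par palm v

  x-sym : ∀ i j → x i j ≡ x j i
  x-sym = proj₁ feasible

  x-nonneg : ∀ i j → 0ℚ ≤ x i j
  x-nonneg i j with adj i j in i~j
  ... | true  = proj₁ (proj₂ (proj₂ feasible)) i j i~j
  ... | false = ≤-reflexive (sym (proj₁ (proj₂ feasible) i j i~j))

  cut-constraint : ∀ S → (∃[ i ] S i ≡ true) → (∃[ j ] S j ≡ false) → 2ℚ ≤ cut adj x S
  cut-constraint = proj₂ (proj₂ (proj₂ feasible))

  degree : xdeg adj x v ≡ Σv (x v)
  degree = Σv-cong at-neighbour
    where
    at-neighbour : ∀ j → (if adj v j then x v j else 0ℚ) ≡ x v j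
    at-neighbour j with adj v j in v~j
    ... | true  = refl
    ... | false = sym (proj₁ (proj₂ feasible) v j v~j)

  R : Fin n → ℚ
  R c = Σv[ T c ] (x v)

  ε : Fin n → ℚ
  ε = εw adj x r par v

  u : Fin n → ℚ
  u = uw adj x r par v

  -- above y a is x_ya if a is a proper ancestor of v, so that
  -- ε c = Σ_{y ∈ T c} Σ_a above y a.
  above : Fin n → Fin n → ℚ
  above y a = if isAnc r par a v ∧ not (a == v) ∧ adj y a then x y a else 0ℚ

  above-nonneg : ∀ y a → 0ℚ ≤ above y a
  above-nonneg y a with isAnc r par a v ∧ not (a == v) ∧ adj y a
  ... | true  = x-nonneg y a
  ... | false = ≤-refl

  R-nonneg : ∀ c → 0ℚ ≤ R c
  R-nonneg c = Σv[]-nonneg (T c) (λ j _ → x-nonneg v j)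

  ε-nonneg : ∀ c → 0ℚ ≤ ε c
  ε-nonneg c = Σv[]-nonneg (T c) (λ y _ → Σv-nonneg (above-nonneg y))

  -- The cut around the subtree of a child c: its edges go to v (counted
  -- in R c) or to proper ancestors of v (counted in ε c).
  subtree-cut : ∀ {c} → child c ≡ true → 2ℚ ≤ R c + ε c
  subtree-cut {c} is-child = begin
    2ℚ                                                ≤⟨ cut-constraint (T c) (c , T-self c) (r , root-outside is-child) ⟩
    cut adj x (T c)                                   ≤⟨ cut-≤ adj x (T c) g 0≤g dominates ⟩
    Σv (λ i → Σv (g i))                               ≡⟨ Σv-cong (λ i → Σv-if (T c i) (λ j → to-v i j + above i j)) ⟩
    Σv[ T c ] (λ i → Σv (λ j → to-v i j + above i j)) ≡⟨ Σv-cong (λ i → cong (λ s → if T c i then s else 0ℚ) (split i)) ⟩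
    Σv[ T c ] (λ i → x v i + Σv (above i))            ≡⟨ Σv[]-+ (T c) (x v) (λ i → Σv (above i)) ⟩
    R c + ε c                                         ∎
    where
    open ≤-Reasoning
    to-v : Fin n → Fin n → ℚ
    to-v i j = if j == v then x i j else 0ℚ
    g : Fin n → Fin n → ℚ
    g i j = if T c i then to-v i j + above i j else 0ℚ
    0≤g : ∀ i j → 0ℚ ≤ g i j
    0≤g i j with T c i
    ... | true  = +-mono-≤ 0≤to-v (above-nonneg i j)
      where
      0≤to-v : 0ℚ ≤ to-v i j
      0≤to-v with j == v
      ... | true  = x-nonneg i j
      ... | false = ≤-refl
    ... | false = ≤-refl
    dominates : ∀ i j → T c i ≡ true → T c j ≡ false → adj i j ≡ true → x i j ≤ g i j
    dominates i j i∈ j∉ i~j rewrite i∈ with subtree-exit is-child i∈ j∉ i~j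
    ... | inj₁ refl = subst (λ b → x i j ≤ (if b then x i j else 0ℚ) + above i j) (sym (==-refl j))
                            (p≤p+q (above-nonneg i j))
    ... | inj₂ (j-anc-v , j≢v) rewrite ==-false j≢v | j-anc-v | i~j = ≤-reflexive (sym (+-identityˡ (x i j)))
    split : ∀ i → Σv (λ j → to-v i j + above i j) ≡ x v i + Σv (above i)
    split i = trans (Σv-+ (to-v i) (above i)) (cong (λ s → s + Σv (above i)) (trans (Σv-δ (x i) v) (x-sym i v)))

  backflow : ∀ c → fB adj x r par v c + x v c ≤ R c
  backflow c = begin
    fB adj x r par v c + x v c       ≤⟨ +-monoˡ-≤ (x v c) (Σv-mono back-arc) ⟩
    Σv[ below-c ] (x v) + x v c      ≡⟨ cong (λ s → Σv[ below-c ] (x v) + s) at-c ⟨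
    Σv[ below-c ] (x v) + Σv[ at ] (x v) ≡⟨ +-comm (Σv[ below-c ] (x v)) (Σv[ at ] (x v)) ⟩
    Σv[ at ] (x v) + Σv[ below-c ] (x v) ≡⟨ Σv-split (T c) (_== c) (x v) ⟨
    R c                              ∎
    where
    open ≤-Reasoning
    below-c at : Fin n → Bool
    below-c y = T c y ∧ not (y == c)
    at y = T c y ∧ (y == c)
    at-c : Σv[ at ] (x v) ≡ x v c
    at-c = trans (Σv-supported _ c off)
                 (trans (cong (λ b → if b ∧ (c == c) then x v c else 0ℚ) (T-self c))
                        (cong (λ b → if b then x v c else 0ℚ) (==-refl c)))
      where
      off : ∀ y → y ≢ c → (if T c y ∧ (y == c) then x v y else 0ℚ) ≡ 0ℚ
      off y y≢c rewrite ==-false y≢c with T c y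
      ... | true  = refl
      ... | false = refl
    back-arc : ∀ y → (if T c y ∧ not (y == c) ∧ adj y v then x y v ⊓ 1ℚ else 0ℚ)
                     ≤ (if T c y ∧ not (y == c) then x v y else 0ℚ)
    back-arc y with T c y | y == c | adj y v
    ... | true  | false | true  = ≤-trans (p⊓q≤p (x y v) 1ℚ) (≤-reflexive (x-sym y v))
    ... | true  | false | false = x-nonneg v y
    ... | true  | true  | _     = ≤-refl
    ... | false | _     | _     = ≤-refl

  u-bound : ∀ c → u c + R c ⊓ 2ℚ ≤ R c
  u-bound c = excess-bound 2ℚ (x v c) (fB adj x r par v c) (R c) (backflow c)

  degree-bound : ∀ (H P : Fin n → Bool) → (∀ c → P c ≡ true → child c ≡ true) →
    (∀ j c → H j ≡ true → P c ≡ true → T c j ≡ false) →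
    Σv[ H ] (x v) + Σv[ P ] R ≤ xdeg adj x v
  degree-bound H P P⇒child H-outside =
    subst (Σv[ H ] (x v) + Σv[ P ] R ≤_) (sym degree)
      (Σv-disjoint (x v) H P T (x-nonneg v) H-outside
        (λ j c c′ Pc Pc′ → subtrees-disjoint (P⇒child c Pc) (P⇒child c′ Pc′)))

  light : Fin n → Bool
  light c = does (ε c <? 1ℚ)

  K N : Fin n → Bool
  K c = child c ∧ light c
  N c = child c ∧ not (light c)

  K⇒child : ∀ c → K c ≡ true → child c ≡ true
  K⇒child c = proj₁ ∘ ∧-true

  VK : Fin n → Bool
  VK j = (j == v) ∨ anyᵇ (λ c → K c ∧ T c j)

  A : ℚ
  A = Σv[ not ∘ VK ] (x v)

  outside-VK : ∀ {j c} → VK j ≡ false → K c ≡ true → T c j ≡ false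
  outside-VK {j} {c} j∉ Kc =
    subst (λ b → b ∧ T c j ≡ false) Kc (anyᵇ-none (λ c → K c ∧ T c j) (proj₂ (∨-false j∉)) c)

  -- The cut around VK: its edges either leave v, or leave the subtree of a
  -- child in K towards a proper ancestor of v.
  union-cut : 2ℚ ≤ A + Σv[ K ] ε
  union-cut = begin
    2ℚ                                      ≤⟨ cut-constraint VK (v , v∈) (r , r∉) ⟩
    cut adj x VK                            ≤⟨ cut-≤ adj x VK g 0≤g dominates ⟩
    Σv (λ i → Σv (g i))                     ≡⟨ Σv-cong (λ i → Σv-+ (from-v i) (λ j → Σv (via-K i j))) ⟩
    Σv (λ i → Σv (from-v i) + Σv (λ j → Σv (via-K i j)))
      ≡⟨ Σv-+ (λ i → Σv (from-v i)) (λ i → Σv (λ j → Σv (via-K i j))) ⟩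
    Σv (λ i → Σv (from-v i)) + Σv (λ i → Σv (λ j → Σv (via-K i j)))
      ≡⟨ cong₂ _+_ total-from-v total-via-K ⟩
    A + Σv[ K ] ε                           ∎
    where
    open ≤-Reasoning
    from-v : Fin n → Fin n → ℚ
    from-v i j = if i == v then (if not (VK j) then x i j else 0ℚ) else 0ℚ
    via-K : Fin n → Fin n → Fin n → ℚ
    via-K i j c = if K c then (if T c i then above i j else 0ℚ) else 0ℚ
    g : Fin n → Fin n → ℚ
    g i j = from-v i j + Σv (via-K i j)

    v∈ : VK v ≡ true
    v∈ rewrite ==-refl v = refl
    r∉ : VK r ≡ false
    r∉ rewrite ==-false (v≢r ∘ sym) = anyᵇ-false _ r-outside
      where
      r-outside : ∀ c → K c ∧ T c r ≡ false
      r-outside c with K c in Kc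
      ... | true  = root-outside (K⇒child c Kc)
      ... | false = refl

    0≤via-K : ∀ i j c → 0ℚ ≤ via-K i j c
    0≤via-K i j c with K c | T c i
    ... | true  | true  = above-nonneg i j
    ... | true  | false = ≤-refl
    ... | false | _     = ≤-refl
    0≤from-v : ∀ i j → 0ℚ ≤ from-v i j
    0≤from-v i j with i == v | not (VK j)
    ... | true  | true  = x-nonneg i j
    ... | true  | false = ≤-refl
    ... | false | _     = ≤-refl
    0≤g : ∀ i j → 0ℚ ≤ g i j
    0≤g i j = +-mono-≤ (0≤from-v i j) (Σv-nonneg (0≤via-K i j))

    dominates : ∀ i j → VK i ≡ true → VK j ≡ false → adj i j ≡ true → x i j ≤ g i j
    dominates i j i∈ j∉ i~j with i == v in i==v
    ... | true rewrite j∉ = p≤p+q (Σv-nonneg (0≤via-K i j))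
    ... | false with anyᵇ-witness (λ c → K c ∧ T c i) i∈
    ...   | c , c-owns-i with ∧-true c-owns-i
    ...     | Kc , i∈Tc with subtree-exit (K⇒child c Kc) i∈Tc (outside-VK j∉ Kc) i~j
    ...       | inj₁ refl = ⊥-elim (clash v∈ j∉)
    ...       | inj₂ (j-anc-v , j≢v) =
      ≤-trans via-K-c (≤-trans (Σv-term (via-K i j) c (0≤via-K i j)) (≤-reflexive (sym (+-identityˡ _))))
      where
      via-K-c : x i j ≤ via-K i j c
      via-K-c rewrite Kc | i∈Tc | j-anc-v | ==-false j≢v | i~j = ≤-refl

    total-from-v : Σv (λ i → Σv (from-v i)) ≡ A
    total-from-v = trans (Σv-cong (λ i → Σv-if (i == v) (λ j → if not (VK j) then x i j else 0ℚ)))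
                         (Σv-δ (λ i → Σv[ not ∘ VK ] (x i)) v)

    total-via-K : Σv (λ i → Σv (λ j → Σv (via-K i j))) ≡ Σv[ K ] ε
    total-via-K = begin-equality
      Σv (λ i → Σv (λ j → Σv (via-K i j)))     ≡⟨ Σv-cong (λ i → Σv-comm (via-K i)) ⟩
      Σv (λ i → Σv (λ c → Σv (λ j → via-K i j c))) ≡⟨ Σv-comm {n} _ ⟩
      Σv (λ c → Σv (λ i → Σv (λ j → via-K i j c))) ≡⟨ Σv-cong per-child ⟩
      Σv[ K ] ε                                ∎
      where
      per-child : ∀ c → Σv (λ i → Σv (λ j → via-K i j c)) ≡ (if K c then ε c else 0ℚ)
      per-child c = trans (Σv-cong inner) (Σv-if (K c) (λ i → if T c i then Σv (above i) else 0ℚ))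
        where
        inner : ∀ i → Σv (λ j → via-K i j c) ≡ (if K c then (if T c i then Σv (above i) else 0ℚ) else 0ℚ)
        inner i = trans (Σv-if (K c) (λ j → if T c i then above i j else 0ℚ))
                        (cong (λ s → if K c then s else 0ℚ) (Σv-if (T c i) (above i)))

  light-<1 : ∀ c → light c ≡ true → ε c < 1ℚ
  light-<1 c = does-true (ε c <? 1ℚ)

  heavy-≥1 : ∀ c → light c ≡ false → 1ℚ ≤ ε c
  heavy-≥1 c = ≮⇒≥ ∘ does-false (ε c <? 1ℚ)

  ℓ : Fin n → ℚ
  ℓ c = 0ℚ ⊔ (1ℚ - ε c)

  ℓ-on-N : Σv[ N ] ℓ ≡ 0ℚ
  ℓ-on-N = trans (Σv-cong vanish) (Σv-zero {n})
    where
    vanish : ∀ c → (if N c then ℓ c else 0ℚ) ≡ 0ℚ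
    vanish c with N c in Nc
    ... | false = refl
    ... | true  = p≥q⇒p⊔q≡p (subst (1ℚ - ε c ≤_) (+-inverseʳ (ε c)) (+-monoˡ-≤ (- ε c) (heavy-≥1 c heavy)))
      where
      heavy : light c ≡ false
      heavy = not-true (proj₂ (∧-true {child c} Nc))

  K-bound : Σv[ K ] ℓ + Σv[ K ] ℓ + Σv[ K ] u + Σv[ K ] ε ≤ Σv[ K ] R
  K-bound = begin
    Σv[ K ] ℓ + Σv[ K ] ℓ + Σv[ K ] u + Σv[ K ] ε
      ≡⟨ cong (λ s → s + Σv[ K ] u + Σv[ K ] ε) (Σv[]-+ K ℓ ℓ) ⟨
    Σv[ K ] (λ c → ℓ c + ℓ c) + Σv[ K ] u + Σv[ K ] ε
      ≡⟨ cong (λ s → s + Σv[ K ] ε) (Σv[]-+ K (λ c → ℓ c + ℓ c) u) ⟨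
    Σv[ K ] (λ c → ℓ c + ℓ c + u c) + Σv[ K ] ε
      ≡⟨ Σv[]-+ K (λ c → ℓ c + ℓ c + u c) ε ⟨
    Σv[ K ] (λ c → ℓ c + ℓ c + u c + ε c)
      ≤⟨ Σv[]-mono K per-child ⟩
    Σv[ K ] R ∎
    where
    open ≤-Reasoning
    per-child : ∀ c → K c ≡ true → ℓ c + ℓ c + u c + ε c ≤ R c
    per-child c Kc = child-bound (ε-nonneg c) (<⇒≤ (light-<1 c (proj₂ (∧-true Kc))))
                                 (subtree-cut (K⇒child c Kc)) (u-bound c)

  N-bound : Σv[ N ] u + (Σv[ N ] R) ⊓ 2ℚ ≤ Σv[ N ] R
  N-bound = begin
    Σv[ N ] u + (Σv[ N ] R) ⊓ 2ℚ        ≤⟨ +-monoʳ-≤ (Σv[ N ] u) (Σv[]-⊓ N R-nonneg (<⇒≤ (positive⁻¹ 2ℚ))) ⟩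
    Σv[ N ] u + Σv[ N ] (λ c → R c ⊓ 2ℚ) ≡⟨ Σv[]-+ N u (λ c → R c ⊓ 2ℚ) ⟨
    Σv[ N ] (λ c → u c + R c ⊓ 2ℚ)       ≤⟨ Σv[]-mono N (λ c _ → u-bound c) ⟩
    Σv[ N ] R                            ∎
    where open ≤-Reasoning

  A-bound : A + Σv[ K ] R ≤ xdeg adj x v
  A-bound = degree-bound (not ∘ VK) K K⇒child (λ j c j∉ → outside-VK (not-true j∉))

  children-bound : Σv[ K ] R + Σv[ N ] R ≤ xdeg adj x v
  children-bound = subst (_≤ xdeg adj x v)
    (trans (cong (λ s → s + Σv[ child ] R) (Σv-zero {n})) (trans (+-identityˡ _) (Σv-split child light R)))
    (degree-bound (λ _ → false) child (λ _ is-child → is-child) (λ _ _ ()))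

  theorem : Σv[ child ] ℓ ≤ (+ 5 / 6) * (xdeg adj x v - 2ℚ - Σv[ child ] u)
  theorem = half⇒five-sixths (Σv[]-nonneg child (λ c _ → p≤p⊔q 0ℚ (1ℚ - ε c))) doubled
    where
    ℓ-split : Σv[ child ] ℓ ≡ Σv[ K ] ℓ
    ℓ-split = trans (Σv-split child light ℓ) (trans (cong (λ s → Σv[ K ] ℓ + s) ℓ-on-N) (+-identityʳ _))
    doubled : Σv[ child ] ℓ + Σv[ child ] ℓ ≤ xdeg adj x v - 2ℚ - Σv[ child ] u
    doubled = subst₂ _≤_ (cong (λ s → s + s) (sym ℓ-split))
                         (cong (λ s → xdeg adj x v - 2ℚ - s) (sym (Σv-split child light u)))
                         (linear-core {X = xdeg adj x v} {A = A} {L = Σv[ K ] ℓ} {Eₖ = Σv[ K ] ε}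
                                      {Rₖ = Σv[ K ] R} {Rₙ = Σv[ N ] R} {Uₖ = Σv[ K ] u} {Uₙ = Σv[ N ] u}
                                      K-bound N-bound union-cut A-bound children-bound
                                      (Σv[]-nonneg K (λ c _ → ε-nonneg c)))

lemma7 : ∀ {n} (adj : Graph n) → IsSimple adj → TwoVertexConnected adj →
         (x : EdgeVec n) → Optimal adj x → Extreme adj x →
         (∀ (i j : Fin n) → adj i j ≡ true → 0ℚ < x i j) →
         (r : Fin n) (par : Fin n → Fin n) → IsGreedyDFSTree adj x r par →
         (v : Fin n) → v ≢ r →
         Σv[ isChild r par v ] (λ c → 0ℚ ⊔ (1ℚ - εw adj x r par v c))
           ≤ (+ 5 / 6) * (xdeg adj x v - (+ 2 / 1) - Σv[ isChild r par v ] (λ c → uw adj x r par v c))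
lemma7 adj (adj-sym , _) (_ , connected , _) x (feasible , _) _ _ r par dfs v v≢r =
  AtVertex.theorem adj x feasible r par palm v v≢r
  where
  palm : IsPalmTree adj r par
  palm = DepthFirstSearch.dfs-palm-tree adj adj-sym x r par connected dfs
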